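{- Let $D$ be a digraph rooted at $r$ and let $v\in V(D)\setminus\{r\}$. For every $I\in\mathcal{G}_{D-rv}(v)$ and every $S\in\mathfrak{S}_D(v)$ there is an $\mathcal{R}\in\mathfrak{P}_D(v)$ orthogonal to $S$ with $I\subseteq E^+(\mathcal{R})$.
   Context: Digraphs have no loops or parallel edges; $D-rv$ means $D$ if $rv\notin E(D)$. An $(r,v)$-path-system is a set of pairwise internally disjoint directed paths from $r$ to $v$; $E^+(\mathcal{P})$ is the set of last edges of the paths in $\mathcal{P}$. For a digraph $H$ and vertex $v$, $\mathcal{G}_H(v)$ is the set of all $I\subseteq \mathrm{in}_H(v)$ (edges with head $v$) such that $I=E^+(\mathcal{P})$ for some $(r,v)$-path-system $\mathcal{P}$ in $H$. An $(r,v)$-separation is a set $S\subseteq V\setminus\{r,v\}$ meeting every $(r,v)$-path. A set of paths $\mathcal P$ and a vertex set $S$ are orthogonal if $|V(P)\cap S|=1$ for all $P\in\mathcal{P}$ and $S\subseteq\bigcup_{P\in\mathcal{P}}V(P)$. $\mathfrak{P}_D(v)$ denotes the set of $(r,v)$-path-systems in $D-rv$ that are orthogonal to some $(r,v)$-separation of $D-rv$, and $\mathfrak{S}_D(v)$ denotes the set of $(r,v)$-separations of $D-rv$ that are orthogonal to some $(r,v)$-path-system in $D-rv$. -}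

module Defs where

open import Data.Nat using (ℕ)
open import Data.Fin using (Fin; _≟_)
open import Data.Bool using (Bool; true; false; T; if_then_else_; _∧_)
open import Data.List using (List; []; _∷_; filter; length)
open import Data.List.Membership.Propositional using (_∈_)
open import Data.List.Relation.Unary.Unique.Propositional using (Unique)
open import Data.Maybe using (Maybe; just; nothing)
open import Data.Product using (Σ; ∃; _×_; _,_; proj₁; proj₂)
open import Data.Empty using (⊥)
open import Relation.Nullary using (¬_; ⌊_⌋)
open import Relation.Binary.PropositionalEquality using (_≡_; _≢_)
import Data.Fin.Subset as Sub
open import Data.Fin.Subset using (Subset)
open import Data.Fin.Subset.Properties using (_∈?_)

-- A finite digraph on vertex set Fin n: adjacency relation, no loops.
-- (No parallel edges is automatic: edges are ordered pairs.)
record Digraph (n : ℕ) : Set where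
  field
    adj     : Fin n → Fin n → Bool
    loopless : ∀ u → adj u u ≡ false
open Digraph public

Edge : ℕ → Set
Edge n = Fin n × Fin n

delEdge : ∀ {n} → Digraph n → Fin n → Fin n → Digraph n
adj (delEdge D r v) x y = if ⌊ x ≟ r ⌋ ∧ ⌊ y ≟ v ⌋ then false else adj D x y
loopless (delEdge D r v) u with ⌊ u ≟ r ⌋ ∧ ⌊ u ≟ v ⌋
... | true  = _≡_.refl
... | false = loopless D u

data Walk {n} (D : Digraph n) : Fin n → Fin n → Set where
  here : ∀ {u} → Walk D u u
  step : ∀ {u w v} → T (adj D u w) → Walk D w v → Walk D u v

verts : ∀ {n} {D : Digraph n} {u v} → Walk D u v → List (Fin n)
verts {u = u} here = u ∷ []
verts {u = u} (step _ w) = u ∷ verts w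

initVerts : ∀ {n} {D : Digraph n} {u v} → Walk D u v → List (Fin n)
initVerts here = []
initVerts {u = u} (step _ w) = u ∷ initVerts w

interior : ∀ {n} {D : Digraph n} {u v} → Walk D u v → List (Fin n)
interior here = []
interior (step _ w) = initVerts w

lastEdge : ∀ {n} {D : Digraph n} {u v} → Walk D u v → Maybe (Edge n)
lastEdge here = nothing
lastEdge {u = u} (step {w = w} _ here) = just (u , w)
lastEdge (step _ (step e p)) = lastEdge (step e p)

record Path {n} (D : Digraph n) (u v : Fin n) : Set where
  constructor mkPath
  field
    walk   : Walk D u v
    unique : Unique (verts walk)
open Path public

record PathSystem {n} (D : Digraph n) (r v : Fin n) : Set where
  field
    size  : ℕ
    path  : Fin size → Path D r v
    distinct : ∀ i j → i ≢ j → verts (walk (path i)) ≢ verts (walk (path j))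
    intDisjoint : ∀ i j → i ≢ j → ∀ x →
      x ∈ interior (walk (path i)) → x ∈ interior (walk (path j)) → ⊥
open PathSystem public

EdgeSet : ℕ → Set₁
EdgeSet n = Edge n → Set

lastEdges : ∀ {n} {D : Digraph n} {r v} → PathSystem D r v → EdgeSet n
lastEdges P e = ∃ λ i → lastEdge (walk (path P i)) ≡ just e

_⊆ᴱ_ : ∀ {n} → EdgeSet n → EdgeSet n → Set
I ⊆ᴱ J = ∀ e → I e → J e

_≡ᴱ_ : ∀ {n} → EdgeSet n → EdgeSet n → Set
I ≡ᴱ J = (I ⊆ᴱ J) × (J ⊆ᴱ I)

inEdges : ∀ {n} → Digraph n → Fin n → EdgeSet n
inEdges H v (x , y) = (y ≡ v) × T (adj H x y)

𝒢 : ∀ {n} → Digraph n → Fin n → Fin n → EdgeSet n → Set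
𝒢 H r v I = (I ⊆ᴱ inEdges H v) × Σ (PathSystem H r v) (λ P → I ≡ᴱ lastEdges P)

IsSeparation : ∀ {n} → Digraph n → Fin n → Fin n → Subset n → Set
IsSeparation H r v S =
  ¬ (r Sub.∈ S) × ¬ (v Sub.∈ S) ×
  (∀ (P : Path H r v) → ∃ λ x → (x ∈ verts (walk P)) × (x Sub.∈ S))

Orthogonal : ∀ {n} {H : Digraph n} {r v} → PathSystem H r v → Subset n → Set
Orthogonal P S =
  (∀ i → length (filter (_∈? S) (verts (walk (path P i)))) ≡ 1) ×
  (∀ x → x Sub.∈ S → ∃ λ i → x ∈ verts (walk (path P i)))

IsIn𝔓 : ∀ {n} (D : Digraph n) (r v : Fin n) → PathSystem (delEdge D r v) r v → Set
IsIn𝔓 D r v P = ∃ λ S → IsSeparation (delEdge D r v) r v S × Orthogonal P S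

IsIn𝔖 : ∀ {n} (D : Digraph n) (r v : Fin n) → Subset n → Set
IsIn𝔖 D r v S = IsSeparation (delEdge D r v) r v S ×
  Σ (PathSystem (delEdge D r v) r v) (λ P → Orthogonal P S)

module Submission where

-- Let Q be a path system orthogonal to S and P one with I ⊆ E⁺(P).  Each Q i
-- meets S exactly once, in s i, and each P j meets S last in t j.  Above S, the
-- segments s i … v of Q and t j … v of P are two fans into v, and every
-- t j is some s i.  The rerouting lemma turns the first fan into a new one,
-- still starting at the s i, that contains every last edge of the second.
-- Prefixing the new walks with the parts of Q below S gives R: these parts
-- avoid S and cannot meet the parts of P after S since S separates r from v,
-- so R consists of paths, each meeting S once, and R covers S as Q does.

open import Defs
open import Data.Nat using (ℕ; zero; suc; _+_; _<_)
open import Data.Nat.Properties using (<-irrefl; suc-injective; <-≤-trans; ≤-pred; n<1+n; +-monoˡ-<; +-monoʳ-<)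
open import Data.Fin using (Fin; _≟_) renaming (zero to fzero; suc to fsuc)
import Data.Fin.Properties as FinP
open import Data.Fin.Subset using (Subset)
import Data.Fin.Subset as Sub
open import Data.Fin.Subset.Properties using (_∈?_)
open import Data.Bool using (T)
open import Data.Maybe using (Maybe; just; nothing)
open import Data.List using (List; []; _∷_; _++_; [_]; filter; length)
open import Data.List.Properties using (++-assoc; ∷-injective; ∷-injectiveˡ; ∷-injectiveʳ; ∷ʳ-injectiveʳ; filter-none; filter-some; filter-accept; filter-++)
open import Data.List.Membership.Propositional using (_∈_; _∉_; find; lose)
open import Data.List.Membership.Propositional.Properties using (∈-++⁺ˡ; ∈-++⁺ʳ; ∈-++⁻; ∈-∃++)
import Data.List.Membership.DecPropositional as DecMembership
open import Data.List.Relation.Unary.Any using (here; there; any?)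
open import Data.List.Relation.Unary.All as All using (All; []; _∷_)
import Data.List.Relation.Unary.All.Properties as AllP
open import Data.List.Relation.Unary.All.Properties using (¬Any⇒All¬; All¬⇒¬Any)
open import Data.List.Relation.Unary.AllPairs using ([]; _∷_)
open import Data.List.Relation.Unary.Unique.Propositional using (Unique)
import Data.List.Relation.Unary.Unique.Propositional.Properties as Unique
open import Data.List.Relation.Unary.Unique.Propositional.Properties using (Unique[x∷xs]⇒x∉xs)
open import Data.Product using (Σ; ∃; ∃₂; _×_; _,_; proj₁; proj₂)
open import Data.Sum using (_⊎_; inj₁; inj₂; [_,_]′)
open import Data.Empty using (⊥; ⊥-elim)
open import Function using (id)
open import Relation.Nullary using (¬_; yes; no)
open import Relation.Nullary.Decidable using (¬?; _×-dec_)
open import Relation.Binary.PropositionalEquality using (_≡_; _≢_; ≢-sym; refl; sym; trans; cong; cong₂; subst; module ≡-Reasoning)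

module ListFacts {A : Set} where

  unique-++⁻ˡ : ∀ (p : List A) {q} → Unique (p ++ q) → Unique p
  unique-++⁻ˡ []      _         = []
  unique-++⁻ˡ (x ∷ p) (x∉ ∷ pq) = AllP.++⁻ˡ p x∉ ∷ unique-++⁻ˡ p pq

  unique-++⁻ʳ : ∀ (p : List A) {q} → Unique (p ++ q) → Unique q
  unique-++⁻ʳ []      pq       = pq
  unique-++⁻ʳ (x ∷ p) (_ ∷ pq) = unique-++⁻ʳ p pq

  unique-++⁻-disjoint : ∀ (p : List A) {q y} → Unique (p ++ q) → y ∈ p → y ∈ q → ⊥
  unique-++⁻-disjoint (x ∷ p) (x∉ ∷ _)  (here refl) y∈q = All¬⇒¬Any (AllP.++⁻ʳ p x∉) y∈q
  unique-++⁻-disjoint (x ∷ p) (_ ∷ pq) (there y∈p) y∈q = unique-++⁻-disjoint p pq y∈p y∈q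

  unique-split : ∀ (p p' : List A) {x q q'} → Unique (p ++ x ∷ q) →
    p ++ x ∷ q ≡ p' ++ x ∷ q' → p ≡ p' × q ≡ q'
  unique-split []      []       _        refl = refl , refl
  unique-split []      (y ∷ p') (x∉ ∷ _) refl = ⊥-elim (All¬⇒¬Any x∉ (∈-++⁺ʳ p' (here refl)))
  unique-split (y ∷ p) []       (x∉ ∷ _) refl = ⊥-elim (All¬⇒¬Any x∉ (∈-++⁺ʳ p (here refl)))
  unique-split (y ∷ p) (y' ∷ p') (_ ∷ u) e with ∷-injective e
  ... | refl , e' with unique-split p p' u e'
  ... | refl , refl = refl , refl

  unique-prefix : ∀ (p : List A) {x q} → Unique (p ++ x ∷ q) → Unique (p ++ [ x ])
  unique-prefix p {x} {q} u = unique-++⁻ˡ (p ++ [ x ]) (subst Unique (sym (++-assoc p [ x ] q)) u)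

  head∉suffix : ∀ (p : List A) {h x q ys} → Unique (p ++ x ∷ q) → h ∷ ys ≡ p ++ x ∷ q → h ∉ q
  head∉suffix []      (x∉ ∷ _) refl m = All¬⇒¬Any x∉ m
  head∉suffix (z ∷ p) u        refl m = unique-++⁻-disjoint (z ∷ p) u (here refl) (there m)

  last∈suffix : ∀ (p : List A) {x q zs w} → p ++ x ∷ q ≡ zs ++ [ w ] → w ∈ x ∷ q
  last∈suffix []      {zs = zs} {w} e = subst (w ∈_) (sym e) (∈-++⁺ʳ zs (here refl))
  last∈suffix (_ ∷ [])    {zs = []}    ()
  last∈suffix (_ ∷ _ ∷ _) {zs = []}    ()
  last∈suffix (_ ∷ p)     {zs = _ ∷ _} e = last∈suffix p (∷-injectiveʳ e)

  head∈init : ∀ {x w : A} {ys zs} → x ∷ ys ≡ zs ++ [ w ] → x ≢ w → x ∈ zs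
  head∈init {zs = []}    e x≢w = ⊥-elim (x≢w (∷-injectiveˡ e))
  head∈init {zs = _ ∷ _} e _   = here (∷-injectiveˡ e)

  Before : List A → A → A → Set
  Before xs y z = ∃₂ λ p q → xs ≡ p ++ z ∷ q × y ∈ p

  Before-∈ : ∀ {xs y z} → Before xs y z → z ∈ xs
  Before-∈ (p , q , refl , _) = ∈-++⁺ʳ p (here refl)

  Before-after : ∀ {xs y z} p q → Unique xs → xs ≡ p ++ z ∷ q → y ∈ q → ¬ Before xs y z
  Before-after p q u refl y∈q (p' , q' , e , y∈p') with unique-split p p' u e
  ... | refl , refl = unique-++⁻-disjoint p u y∈p' (there y∈q)

  Before-trans : ∀ {xs x y z} → Unique xs → Before xs x y → Before xs y z → Before xs x z
  Before-trans {y = y} {z} u (p₁ , q₁ , e₁ , x∈p₁) (p₂ , q₂ , refl , y∈p₂) with ∈-∃++ y∈p₂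
  ... | a , b , refl with unique-split p₁ a (subst Unique e₁ u) (trans (sym e₁) (++-assoc a (y ∷ b) (z ∷ q₂)))
  ... | refl , _ = a ++ y ∷ b , q₂ , refl , ∈-++⁺ˡ x∈p₁

  Before-total : ∀ (xs : List A) {x z} → x ∈ xs → z ∈ xs → x ≢ z → Before xs x z ⊎ Before xs z x
  Before-total (w ∷ xs) (here refl) (here refl) x≢z = ⊥-elim (x≢z refl)
  Before-total (w ∷ xs) (here refl) (there z∈xs) _ with ∈-∃++ z∈xs
  ... | p , q , refl = inj₁ (w ∷ p , q , refl , here refl)
  Before-total (w ∷ xs) (there x∈xs) (here refl) _ with ∈-∃++ x∈xs
  ... | p , q , refl = inj₂ (w ∷ p , q , refl , here refl)
  Before-total (w ∷ xs) (there x∈xs) (there z∈xs) x≢z with Before-total xs x∈xs z∈xs x≢z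
  ... | inj₁ (p , q , e , m) = inj₁ (w ∷ p , q , cong (w ∷_) e , there m)
  ... | inj₂ (p , q , e , m) = inj₂ (w ∷ p , q , cong (w ∷_) e , there m)

open ListFacts

-- Walks of a digraph presented by their vertex sequence, which makes cutting
-- and gluing walks a matter of list concatenation.
module Chains {n} (H : Digraph n) where

  V : Set
  V = Fin n

  data Chain : V → List V → V → Set where
    end  : ∀ {u} → Chain u [ u ] u
    edge : ∀ {u w xs v} → T (adj H u w) → Chain w xs v → Chain u (u ∷ xs) v

  walk→chain : ∀ {u v} (w : Walk H u v) → Chain u (verts w) v
  walk→chain here       = end
  walk→chain (step e w) = edge e (walk→chain w)

  chain→walk : ∀ {u xs v} → Chain u xs v → Σ (Walk H u v) λ w → verts w ≡ xs
  chain→walk end = here , refl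
  chain→walk (edge e c) with chain→walk c
  ... | w , refl = step e w , refl

  chain-head : ∀ {u xs v} → Chain u xs v → ∃ λ ys → xs ≡ u ∷ ys
  chain-head end        = [] , refl
  chain-head (edge _ _) = _ , refl

  chain-last : ∀ {u xs v} → Chain u xs v → ∃ λ ys → xs ≡ ys ++ [ v ]
  chain-last end = [] , refl
  chain-last {u} (edge _ c) with chain-last c
  ... | ys , refl = u ∷ ys , refl

  chain-split : ∀ p {u x q w} → Chain u (p ++ x ∷ q) w → Chain u (p ++ [ x ]) x × Chain x (x ∷ q) w
  chain-split []          end        = end , end
  chain-split []          (edge e c) = end , edge e c
  chain-split (_ ∷ [])    (edge e c) with chain-split [] c
  ... | c₁ , c₂ = edge e c₁ , c₂
  chain-split (_ ∷ y ∷ p) (edge e c) with chain-split (y ∷ p) c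
  ... | c₁ , c₂ = edge e c₁ , c₂

  chain-join : ∀ p {u x ys w} → Chain u (p ++ [ x ]) x → Chain x ys w → Chain u (p ++ ys) w
  chain-join []          end                 c₂ = c₂
  chain-join (_ ∷ [])    (edge e end)        c₂ with chain-head c₂
  ... | _ , refl = edge e c₂
  chain-join (_ ∷ y ∷ p) (edge e c)          c₂ = edge e (chain-join (y ∷ p) c c₂)

  chain-shortcut : ∀ {u xs v} → Chain u xs v → ∃ λ ys → Chain u ys v × Unique ys × (∀ {y} → y ∈ ys → y ∈ xs)
  chain-shortcut {u} end = [ u ] , end , [] ∷ [] , λ m → m
  chain-shortcut {u} (edge e c) with chain-shortcut c
  ... | ys , c' , u' , sub with DecMembership._∈?_ _≟_ u ys
  ... | yes u∈ys with ∈-∃++ u∈ys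
  ...   | p , q , refl = u ∷ q , proj₂ (chain-split p c') , unique-++⁻ʳ p u' , λ m → there (sub (∈-++⁺ʳ p m))
  chain-shortcut {u} (edge e c) | ys , c' , u' , sub | no u∉ys =
    u ∷ ys , edge e c' , ¬Any⇒All¬ ys u∉ys ∷ u' , λ { (here refl) → here refl ; (there m) → there (sub m) }

  chain→path : ∀ {u xs v} → Chain u xs v → Σ (Path H u v) λ P → ∀ {y} → y ∈ verts (walk P) → y ∈ xs
  chain→path c with chain-shortcut c
  ... | ys , c' , u' , sub with chain→walk c'
  ... | w , refl = mkPath w u' , sub

  lastEdgeˡ : List V → Maybe (Edge n)
  lastEdgeˡ (x ∷ y ∷ [])     = just (x , y)
  lastEdgeˡ (x ∷ y ∷ z ∷ zs) = lastEdgeˡ (y ∷ z ∷ zs)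
  lastEdgeˡ _                = nothing

  lastEdge-verts : ∀ {u v} (w : Walk H u v) → lastEdge w ≡ lastEdgeˡ (verts w)
  lastEdge-verts here                           = refl
  lastEdge-verts (step _ here)                  = refl
  lastEdge-verts (step _ (step _ here))         = refl
  lastEdge-verts (step _ (step e (step e' w))) = lastEdge-verts (step e (step e' w))

  lastEdge-++ : ∀ (p : List V) {x y ys} → lastEdgeˡ (p ++ x ∷ y ∷ ys) ≡ lastEdgeˡ (x ∷ y ∷ ys)
  lastEdge-++ []              = refl
  lastEdge-++ (_ ∷ [])        = refl
  lastEdge-++ (_ ∷ _ ∷ [])    = refl
  lastEdge-++ (_ ∷ b ∷ c ∷ p) = lastEdge-++ (b ∷ c ∷ p)

  lastEdge-++-last : ∀ (p : List V) {x} q {w} → lastEdgeˡ (p ++ x ∷ q ++ [ w ]) ≡ lastEdgeˡ (x ∷ q ++ [ w ])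
  lastEdge-++-last p []      = lastEdge-++ p
  lastEdge-++-last p (_ ∷ _) = lastEdge-++ p

  lastEdge-++-chain : ∀ p {u xs w} → Chain u xs w → u ≢ w → lastEdgeˡ (p ++ xs) ≡ lastEdgeˡ xs
  lastEdge-++-chain p end        u≢w = ⊥-elim (u≢w refl)
  lastEdge-++-chain p (edge _ c) _   with chain-head c
  ... | _ , refl = lastEdge-++ p

  verts-initVerts : ∀ {u v} (w : Walk H u v) → verts w ≡ initVerts w ++ [ v ]
  verts-initVerts here       = refl
  verts-initVerts (step _ w) = cong (_ ∷_) (verts-initVerts w)

  ∈-initVerts : ∀ {u v x} (w : Walk H u v) → x ∈ verts w → x ≢ v → x ∈ initVerts w
  ∈-initVerts here       (here refl) x≢v = ⊥-elim (x≢v refl)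
  ∈-initVerts (step _ w) (here refl) _   = here refl
  ∈-initVerts (step _ w) (there m)   x≢v = there (∈-initVerts w m x≢v)

  ∈-interior : ∀ {u v x} (w : Walk H u v) → x ∈ verts w → x ≢ u → x ≢ v → x ∈ interior w
  ∈-interior here       (here refl) x≢u _   = ⊥-elim (x≢u refl)
  ∈-interior (step _ w) (here refl) x≢u _   = ⊥-elim (x≢u refl)
  ∈-interior (step _ w) (there m)   _   x≢v = ∈-initVerts w m x≢v

  interior⁻ : ∀ {u v x} (w : Walk H u v) → Unique (verts w) → x ∈ interior w →
    x ∈ verts w × x ≢ u × x ≢ v
  interior⁻ {v = v} {x} (step _ w) (u∉ ∷ uw) m =
    there x∈w , (λ { refl → All¬⇒¬Any u∉ x∈w }) ,
    (λ { refl → unique-++⁻-disjoint (initVerts w) (subst Unique (verts-initVerts w) uw) m (here refl) })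
    where
    x∈w : x ∈ verts w
    x∈w = subst (x ∈_) (sym (verts-initVerts w)) (∈-++⁺ˡ m)

  record Fan (v : V) : Set where
    field
      size   : ℕ
      start  : Fin size → V
      seq    : Fin size → List V
      chain  : ∀ i → Chain (start i) (seq i) v
      unique : ∀ i → Unique (seq i)
      meet   : ∀ i i' → i ≢ i' → ∀ {y} → y ∈ seq i → y ∈ seq i' → y ≡ v

module Crossings {n} (S : Subset n) where

  Avoids : List (Fin n) → Set
  Avoids = All (λ y → ¬ (y Sub.∈ S))

  count : List (Fin n) → ℕ
  count xs = length (filter (_∈? S) xs)

  count-zero : ∀ xs → count xs ≡ 0 → Avoids xs
  count-zero xs e = ¬Any⇒All¬ xs (λ some → <-irrefl refl (subst (0 <_) e (filter-some (_∈? S) some)))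

  count-one : ∀ A {s B} → Avoids A → s Sub.∈ S → Avoids B → count (A ++ s ∷ B) ≡ 1
  count-one A {s} {B} avA s∈S avB = cong length (begin
    filter (_∈? S) (A ++ s ∷ B)                 ≡⟨ filter-++ (_∈? S) A (s ∷ B) ⟩
    filter (_∈? S) A ++ filter (_∈? S) (s ∷ B)  ≡⟨ cong (_++ filter (_∈? S) (s ∷ B)) (filter-none (_∈? S) avA) ⟩
    filter (_∈? S) (s ∷ B)                      ≡⟨ filter-accept (_∈? S) s∈S ⟩
    s ∷ filter (_∈? S) B                        ≡⟨ cong (s ∷_) (filter-none (_∈? S) avB) ⟩
    [ s ]                                       ∎)
    where open ≡-Reasoning

  record CrossesOnce (xs : List (Fin n)) : Set where
    field
      pre    : List (Fin n)
      mid    : Fin n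
      post   : List (Fin n)
      split  : xs ≡ pre ++ mid ∷ post
      pre-avoids  : Avoids pre
      mid∈S       : mid Sub.∈ S
      post-avoids : Avoids post

  crosses-once : ∀ xs → count xs ≡ 1 → CrossesOnce xs
  crosses-once (x ∷ xs) e with x ∈? S
  ... | yes x∈S = record { pre = [] ; mid = x ; post = xs ; split = refl ; pre-avoids = []
                         ; mid∈S = x∈S ; post-avoids = count-zero xs (suc-injective e) }
  ... | no  x∉S = record { pre = x ∷ pre ; mid = mid ; post = post ; split = cong (x ∷_) split
                         ; pre-avoids = x∉S ∷ pre-avoids ; mid∈S = mid∈S ; post-avoids = post-avoids }
    where open CrossesOnce (crosses-once xs e)

  record LastCrossing (xs : List (Fin n)) : Set where
    field
      pre    : List (Fin n)
      mid    : Fin n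
      post   : List (Fin n)
      split  : xs ≡ pre ++ mid ∷ post
      mid∈S       : mid Sub.∈ S
      post-avoids : Avoids post

  last-crossing : ∀ xs {x} → x ∈ xs → x Sub.∈ S → LastCrossing xs
  last-crossing (x' ∷ xs) x∈ x∈S with any? (_∈? S) xs
  ... | yes later = record { pre = x' ∷ pre ; mid = mid ; post = post ; split = cong (x' ∷_) split
                           ; mid∈S = mid∈S ; post-avoids = post-avoids }
    where open LastCrossing (last-crossing xs (proj₁ (proj₂ (find later))) (proj₂ (proj₂ (find later))))
  ... | no none with x∈
  ...   | here refl = record { pre = [] ; mid = x' ; post = xs ; split = refl
                             ; mid∈S = x∈S ; post-avoids = ¬Any⇒All¬ xs none }
  ...   | there m   = ⊥-elim (none (lose m x∈S))

  only-crossing : ∀ A {s B x} → Avoids A → Avoids B → x ∈ A ++ s ∷ B → x Sub.∈ S → x ≡ s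
  only-crossing A avA avB m x∈S with ∈-++⁻ A m
  ... | inj₁ x∈A      = ⊥-elim (All.lookup avA x∈A x∈S)
  ... | inj₂ (here e)  = e
  ... | inj₂ (there x∈B) = ⊥-elim (All.lookup avB x∈B x∈S)

sumᶠ : ∀ {a} → (Fin a → ℕ) → ℕ
sumᶠ {zero}  f = 0
sumᶠ {suc a} f = f fzero + sumᶠ (λ i → f (fsuc i))

sumᶠ-cong : ∀ {a} (f g : Fin a → ℕ) → (∀ i → f i ≡ g i) → sumᶠ f ≡ sumᶠ g
sumᶠ-cong {zero}  f g f≡g = refl
sumᶠ-cong {suc a} f g f≡g = cong₂ _+_ (f≡g fzero) (sumᶠ-cong _ _ (λ i → f≡g (fsuc i)))

sumᶠ-< : ∀ {a} (f g : Fin a → ℕ) (i : Fin a) →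
  (∀ i' → i' ≢ i → f i' ≡ g i') → f i < g i → sumᶠ f < sumᶠ g
sumᶠ-< {suc a} f g fzero others fi<gi
  rewrite sumᶠ-cong (λ i → f (fsuc i)) (λ i → g (fsuc i)) (λ i' → others (fsuc i') (λ ()))
  = +-monoˡ-< (sumᶠ (λ i → g (fsuc i))) fi<gi
sumᶠ-< {suc a} f g (fsuc i) others fi<gi rewrite others fzero (λ ()) =
  +-monoʳ-< (g fzero) (sumᶠ-< (λ i → f (fsuc i)) (λ i → g (fsuc i)) i
    (λ i' i'≢i → others (fsuc i') (λ e → i'≢i (FinP.suc-injective e))) fi<gi)

-- One pointer moves along each walk L i.  A pointer is advanced while it is
-- not at v and lies on no walk of K, or lies on a walk of K strictly behind
-- another pointer.  When no pointer can move, every pointer is at v or is the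
-- only pointer on its walk of K; rerouted walk i follows L i up to its pointer
-- and then the walk of K through it.
module Rerouting {n} {H : Digraph n} {v : Fin n} (L K : Chains.Fan H v)
  (K-start≢v : ∀ j → Chains.Fan.start K j ≢ v)
  (K-start∈L : ∀ j → ∃ λ i → Chains.Fan.start K j ≡ Chains.Fan.start L i) where

  open Chains H
  open Fan L using () renaming (size to a; start to s; seq to ℓ)
  open Fan K using () renaming (size to b; start to t; seq to k)
  open DecMembership (_≟_ {n}) using () renaming (_∈?_ to _∈ˡ?_)

  record Rerouted : Set where
    field
      route        : Fin a → List V
      route-chain  : ∀ i → Chain (s i) (route i) v
      route-unique : ∀ i → Unique (route i)
      route-meet   : ∀ i i' → i ≢ i' → ∀ {y} → y ∈ route i → y ∈ route i' → y ≡ v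
      route-⊆      : ∀ i {y} → y ∈ route i → y ∈ ℓ i ⊎ ∃ λ j → y ∈ k j × y ≢ t j
      route-last   : ∀ j → ∃ λ i → lastEdgeˡ (route i) ≡ lastEdgeˡ (k j)

  κ : Fin b → List V
  κ j = proj₁ (chain-last (Fan.chain K j))

  κ-eq : ∀ j → k j ≡ κ j ++ [ v ]
  κ-eq j = proj₂ (chain-last (Fan.chain K j))

  κ-unique : ∀ j → Unique (κ j)
  κ-unique j = unique-++⁻ˡ (κ j) (subst Unique (κ-eq j) (Fan.unique K j))

  v∉κ : ∀ j → v ∉ κ j
  v∉κ j m = unique-++⁻-disjoint (κ j) (subst Unique (κ-eq j) (Fan.unique K j)) m (here refl)

  κ⊆k : ∀ j {y} → y ∈ κ j → y ∈ k j
  κ⊆k j {y} m = subst (y ∈_) (sym (κ-eq j)) (∈-++⁺ˡ m)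

  κ-owner : ∀ {y} j j' → y ∈ κ j → y ∈ κ j' → j ≡ j'
  κ-owner j j' m m' with j ≟ j'
  ... | yes j≡j' = j≡j'
  ... | no  j≢j' = ⊥-elim (v∉κ j (subst (_∈ κ j) (Fan.meet K j j' j≢j' (κ⊆k j m) (κ⊆k j' m')) m))

  t∈κ : ∀ j → t j ∈ κ j
  t∈κ j with chain-head (Fan.chain K j)
  ... | _ , k≡t∷ = head∈init (trans (sym k≡t∷) (κ-eq j)) (K-start≢v j)

  record Pointer (i : Fin a) : Set where
    constructor pointer
    field
      before : List V
      at     : V
      after  : List V
      split  : ℓ i ≡ before ++ at ∷ after
  open Pointer

  State : Set
  State = (i : Fin a) → Pointer i

  X : State → Fin a → V
  X st i = at (st i)

  X∈ℓ : ∀ st i → X st i ∈ ℓ i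
  X∈ℓ st i = subst (X st i ∈_) (sym (split (st i))) (∈-++⁺ʳ (before (st i)) (here refl))

  before⊆ℓ : ∀ st i {y} → y ∈ before (st i) → y ∈ ℓ i
  before⊆ℓ st i {y} m = subst (y ∈_) (sym (split (st i))) (∈-++⁺ˡ {ys = X st i ∷ after (st i)} m)

  Passed : State → Set
  Passed st = ∀ i {y} → y ∈ before (st i) → ∀ j → y ∈ κ j → ∃ λ i' → Before (κ j) y (X st i')

  Covered : State → Set
  Covered st = ∀ j → ∃ λ i → X st i ∈ κ j

  Owns : State → Fin a → Fin b → Set
  Owns st i j = X st i ∈ κ j × (∀ i' → i' ≢ i → X st i' ∉ κ j)

  Settled : State → Set
  Settled st = ∀ i → X st i ≡ v ⊎ ∃ (Owns st i)

  Advanceable : State → Fin a → Set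
  Advanceable st i = X st i ≢ v ×
    (∀ {j} → X st i ∈ κ j → ∃ λ i' → i' ≢ i × Before (κ j) (X st i) (X st i'))

  remaining : State → ℕ
  remaining st = sumᶠ (λ i → length (after (st i)))

  -- A pointer not at v can move one vertex forward, since L i ends in v.
  forward : ∀ {i} (p : Pointer i) → at p ≢ v →
    Σ (Pointer i) λ p' → before p' ≡ before p ++ [ at p ] × suc (length (after p')) ≡ length (after p)
  forward {i} (pointer bs x [] eq) x≢v =
    ⊥-elim (x≢v (∷ʳ-injectiveʳ bs (proj₁ (chain-last (Fan.chain L i))) (trans (sym eq) (proj₂ (chain-last (Fan.chain L i))))))
  forward (pointer bs x (y ∷ ys) eq) _ =
    pointer (bs ++ [ x ]) y ys (trans eq (sym (++-assoc bs [ x ] (y ∷ ys)))) , refl , refl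

  update : State → (i : Fin a) → Pointer i → State
  update st i p i' with i' ≟ i
  ... | yes refl = p
  ... | no  _    = st i'

  update-same : ∀ st i p → update st i p i ≡ p
  update-same st i p with i ≟ i
  ... | yes refl = refl
  ... | no  i≢i  = ⊥-elim (i≢i refl)

  update-other : ∀ st i p i' → i' ≢ i → update st i p i' ≡ st i'
  update-other st i p i' i'≢i with i' ≟ i
  ... | yes refl = ⊥-elim (i'≢i refl)
  ... | no  _    = refl

  module Advance (st : State) (i : Fin a) (adv : Advanceable st i) where
    moved = forward (st i) (proj₁ adv)
    st'   = update st i (proj₁ moved)

    X-other : ∀ i' → i' ≢ i → X st' i' ≡ X st i'
    X-other i' i'≢i = cong at (update-other st i _ i' i'≢i)

    before-other : ∀ i' → i' ≢ i → before (st' i') ≡ before (st i')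
    before-other i' i'≢i = cong before (update-other st i _ i' i'≢i)

    before-self : before (st' i) ≡ before (st i) ++ [ X st i ]
    before-self = trans (cong before (update-same st i _)) (proj₁ (proj₂ moved))

    still-behind : ∀ {j y} w → Before (κ j) y (X st w) → ∃ λ i' → Before (κ j) y (X st' i')
    still-behind {j} {y} w bf with i ≟ w
    ... | no  i≢w  = w , subst (Before (κ j) y) (sym (X-other w (≢-sym i≢w))) bf
    ... | yes refl with proj₂ adv (Before-∈ bf)
    ...   | i' , i'≢i , ahead = i' , subst (Before (κ j) y) (sym (X-other i' i'≢i)) (Before-trans (κ-unique j) bf ahead)

    passed : Passed st → Passed st'
    passed P i'' {y} m j y∈κ with i ≟ i''
    ... | no i≢i'' = let (w , bf) = P i'' (subst (y ∈_) (before-other i'' (≢-sym i≢i'')) m) j y∈κ in still-behind w bf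
    ... | yes refl with ∈-++⁻ (before (st i)) (subst (y ∈_) before-self m)
    ...   | inj₁ y∈before = let (w , bf) = P i y∈before j y∈κ in still-behind w bf
    ...   | inj₂ (here refl) =
      let (i' , i'≢i , ahead) = proj₂ adv y∈κ in i' , subst (Before (κ j) y) (sym (X-other i' i'≢i)) ahead

    covered : Covered st → Covered st'
    covered C j with C j
    ... | w , m with i ≟ w
    ...   | no  i≢w  = w , subst (_∈ κ j) (sym (X-other w (≢-sym i≢w))) m
    ...   | yes refl with proj₂ adv m
    ...     | i' , i'≢i , ahead = i' , subst (_∈ κ j) (sym (X-other i' i'≢i)) (Before-∈ ahead)

    decreases : remaining st' < remaining st
    decreases = sumᶠ-< _ _ i (λ i' i'≢i → cong (λ p → length (after p)) (update-other st i _ i' i'≢i))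
      (subst (_< length (after (st i))) (sym (cong (λ p → length (after p)) (update-same st i _)))
        (subst (length (after (proj₁ moved)) <_) (proj₂ (proj₂ moved)) (n<1+n _)))

  -- Two pointers on the same κ j are at different vertices (the walks of L meet only in v).
  pointers-differ : ∀ st i i' → i ≢ i' → ∀ j → X st i ∈ κ j → X st i ≢ X st i'
  pointers-differ st i i' i≢i' j m e =
    v∉κ j (subst (_∈ κ j) (Fan.meet L i i' i≢i' (X∈ℓ st i) (subst (_∈ ℓ i') (sym e) (X∈ℓ st i'))) m)

  behind-advanceable : ∀ st i i' j → i' ≢ i → X st i ∈ κ j → Before (κ j) (X st i) (X st i') → Advanceable st i
  behind-advanceable st i i' j i'≢i m ahead =
    (λ e → v∉κ j (subst (_∈ κ j) e m)) ,
    λ {j'} m' → i' , i'≢i , subst (λ j'' → Before (κ j'') (X st i) (X st i')) (κ-owner j j' m m') ahead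

  progress : ∀ st → ∃ (Advanceable st) ⊎ Settled st
  progress st with FinP.any? (λ i → ¬? (X st i ≟ v) ×-dec FinP.all? (λ j → ¬? (X st i ∈ˡ? κ j)))
  ... | yes (i , x≢v , off) = inj₁ (i , x≢v , λ {j} m → ⊥-elim (off j m))
  ... | no ¬free with FinP.any? (λ i → FinP.any? (λ i' → ¬? (i ≟ i') ×-dec FinP.any? (λ j → (X st i ∈ˡ? κ j) ×-dec (X st i' ∈ˡ? κ j))))
  ...   | yes (i , i' , i≢i' , j , m , m') with Before-total (κ j) m m' (pointers-differ st i i' i≢i' j m)
  ...     | inj₁ ahead = inj₁ (i  , behind-advanceable st i i' j (λ e → i≢i' (sym e)) m ahead)
  ...     | inj₂ ahead = inj₁ (i' , behind-advanceable st i' i j i≢i' m' ahead)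
  progress st | no ¬free | no ¬shared = inj₂ settled
    where
    settled : Settled st
    settled i with X st i ≟ v
    ... | yes x≡v = inj₁ x≡v
    ... | no  x≢v with FinP.any? (λ j → X st i ∈ˡ? κ j)
    ...   | yes (j , m) = inj₂ (j , m , λ i' i'≢i m' → ¬shared (i , i' , (λ e → i'≢i (sym e)) , j , m , m'))
    ...   | no  off     = ⊥-elim (¬free (i , x≢v , λ j m → off (j , m)))

  -- Moving pointers until none can move; `remaining` bounds the number of moves.
  Final : State → Set
  Final st = Passed st × Covered st × Settled st

  run : ∀ fuel st → remaining st < fuel → Passed st → Covered st → Σ State Final
  run (suc fuel) st bound P C with progress st
  ... | inj₂ settled   = st , P , C , settled
  ... | inj₁ (i , adv) = let open Advance st i adv in
    run fuel st' (<-≤-trans decreases (≤-pred bound)) (passed P) (covered C)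

  initial : State
  initial i = pointer [] (s i) (proj₁ (chain-head (Fan.chain L i))) (proj₂ (chain-head (Fan.chain L i)))

  final : Σ State Final
  final = run (suc (remaining initial)) initial (n<1+n _) (λ _ ()) initial-covered
    where
    initial-covered : Covered initial
    initial-covered j = let (i , t≡s) = K-start∈L j in i , subst (_∈ κ j) t≡s (t∈κ j)

  k-split : ∀ j (p : List V) {x q} → κ j ≡ p ++ x ∷ q → k j ≡ p ++ x ∷ q ++ [ v ]
  k-split j p {x} {q} e = trans (κ-eq j) (trans (cong (_++ [ v ]) e) (++-assoc p (x ∷ q) [ v ]))

  ℓ-last : ∀ i → ∃ λ zs → ℓ i ≡ zs ++ [ v ]
  ℓ-last i = chain-last (Fan.chain L i)

  v∉before : ∀ (st : State) i → v ∉ before (st i)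
  v∉before st i m = unique-++⁻-disjoint (before (st i)) (subst Unique (split (st i)) (Fan.unique L i)) m
    (last∈suffix (before (st i)) (trans (sym (split (st i))) (proj₂ (ℓ-last i))))

  module Extract (st : State) (P : Passed st) (C : Covered st) (S : Settled st) where

    data Continuation (i : Fin a) : Set where
      at-v  : X st i ≡ v → Continuation i
      along : ∀ j p q → Owns st i j → κ j ≡ p ++ X st i ∷ q → Continuation i

    continuation : ∀ i → Continuation i
    continuation i with S i
    ... | inj₁ x≡v = at-v x≡v
    ... | inj₂ (j , own) with ∈-∃++ (proj₁ own)
    ...   | p , q , e = along j p q own e

    rest : ∀ {i} → Continuation i → List V
    rest (at-v _)           = []
    rest (along _ _ q _ _) = q ++ [ v ]

    route : Fin a → List V
    route i = before (st i) ++ X st i ∷ rest (continuation i)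

    data Origin (i : Fin a) (y : V) : Set where
      is-v : y ≡ v → Origin i y
      on-L : y ∈ before (st i) ++ [ X st i ] → Origin i y
      on-K : ∀ j p q → Owns st i j → κ j ≡ p ++ X st i ∷ q → y ∈ q → Origin i y

    origin : ∀ i {y} → y ∈ route i → Origin i y
    origin i {y} m with ∈-++⁻ (before (st i)) m
    ... | inj₁ y∈before   = on-L (∈-++⁺ˡ y∈before)
    ... | inj₂ (here refl) = on-L (∈-++⁺ʳ (before (st i)) (here refl))
    ... | inj₂ (there m') with continuation i
    ...   | along j p q own e with ∈-++⁻ q m'
    ...     | inj₁ y∈q       = on-K j p q own e y∈q
    ...     | inj₂ (here y≡v) = is-v y≡v

    passed-not-ahead : ∀ i i' j p q {y} → y ∈ before (st i) → Owns st i' j →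
      κ j ≡ p ++ X st i' ∷ q → y ∈ q → ⊥
    passed-not-ahead i i' j p q {y} y∈before (_ , alone) e y∈q with P i y∈before j (subst (y ∈_) (sym e) (∈-++⁺ʳ p (there y∈q)))
    ... | w , behind with w ≟ i'
    ...   | yes refl = Before-after p q (κ-unique j) e y∈q behind
    ...   | no  w≢i' = alone w w≢i' (Before-∈ behind)

    L-part-vs-K-part : ∀ i i' → i ≢ i' → ∀ j p q {y} → y ∈ before (st i) ++ [ X st i ] →
      Owns st i' j → κ j ≡ p ++ X st i' ∷ q → y ∈ q → ⊥
    L-part-vs-K-part i i' i≢i' j p q m own e y∈q with ∈-++⁻ (before (st i)) m
    ... | inj₁ y∈before   = passed-not-ahead i i' j p q y∈before own e y∈q
    ... | inj₂ (here refl) = proj₂ own i i≢i' (subst (_ ∈_) (sym e) (∈-++⁺ʳ p (there y∈q)))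

    L-part⊆ℓ : ∀ i {y} → y ∈ before (st i) ++ [ X st i ] → y ∈ ℓ i
    L-part⊆ℓ i m with ∈-++⁻ (before (st i)) m
    ... | inj₁ y∈before   = before⊆ℓ st i y∈before
    ... | inj₂ (here refl) = X∈ℓ st i

    route-meet : ∀ i i' → i ≢ i' → ∀ {y} → y ∈ route i → y ∈ route i' → y ≡ v
    route-meet i i' i≢i' m m' with origin i m | origin i' m'
    ... | is-v y≡v | _        = y≡v
    ... | _        | is-v y≡v = y≡v
    ... | on-L a   | on-L a'  = Fan.meet L i i' i≢i' (L-part⊆ℓ i a) (L-part⊆ℓ i' a')
    ... | on-L a   | on-K j p q own e y∈q = ⊥-elim (L-part-vs-K-part i i' i≢i' j p q a own e y∈q)
    ... | on-K j p q own e y∈q | on-L a' = ⊥-elim (L-part-vs-K-part i' i (≢-sym i≢i') j p q a' own e y∈q)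
    ... | on-K j p q own e y∈q | on-K j' p' q' own' e' y∈q' with κ-owner j j'
            (subst (_ ∈_) (sym e) (∈-++⁺ʳ p (there y∈q))) (subst (_ ∈_) (sym e') (∈-++⁺ʳ p' (there y∈q')))
    ...   | refl = ⊥-elim (proj₂ own i' (≢-sym i≢i') (proj₁ own'))

    route-chain : ∀ i → Chain (s i) (route i) v
    route-chain i with continuation i | chain-split (before (st i)) (subst (λ l → Chain (s i) l v) (split (st i)) (Fan.chain L i))
    ... | at-v x≡v        | to-X , _ = subst (Chain (s i) (before (st i) ++ [ X st i ])) x≡v to-X
    ... | along j p q _ e | to-X , _ =
      chain-join (before (st i)) to-X (proj₂ (chain-split p (subst (λ l → Chain (t j) l v) (k-split j p e) (Fan.chain K j))))

    route-unique : ∀ i → Unique (route i)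
    route-unique i with continuation i
    ... | at-v _ = unique-prefix (before (st i)) ℓ-unique
      where ℓ-unique = subst Unique (split (st i)) (Fan.unique L i)
    ... | along j p q own e =
      Unique.++⁺ (unique-++⁻ˡ (before (st i)) ℓ-unique) (unique-++⁻ʳ p (subst Unique (k-split j p e) (Fan.unique K j))) disjoint
      where
      ℓ-unique = subst Unique (split (st i)) (Fan.unique L i)
      disjoint : ∀ {y} → y ∈ before (st i) × y ∈ X st i ∷ q ++ [ v ] → ⊥
      disjoint (y∈before , here refl) = unique-++⁻-disjoint (before (st i)) ℓ-unique y∈before (here refl)
      disjoint (y∈before , there m) with ∈-++⁻ q m
      ... | inj₁ y∈q         = passed-not-ahead i i j p q y∈before own e y∈q
      ... | inj₂ (here refl) = v∉before st i y∈before

    route-⊆ : ∀ i {y} → y ∈ route i → y ∈ ℓ i ⊎ ∃ λ j → y ∈ k j × y ≢ t j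
    route-⊆ i m with origin i m
    ... | is-v refl = inj₁ (subst (v ∈_) (sym (proj₂ (ℓ-last i))) (∈-++⁺ʳ (proj₁ (ℓ-last i)) (here refl)))
    ... | on-L a    = inj₁ (L-part⊆ℓ i a)
    ... | on-K j p q _ e y∈q with chain-head (Fan.chain K j)
    ...   | _ , k≡t∷ = inj₂ (j , subst (_ ∈_) (sym (k-split j p e)) (∈-++⁺ʳ p (there (∈-++⁺ˡ y∈q))) ,
            λ { refl → head∉suffix p (subst Unique (k-split j p e) (Fan.unique K j))
                         (trans (sym k≡t∷) (k-split j p e)) (∈-++⁺ˡ y∈q) })

    route-last : ∀ j → ∃ λ i → lastEdgeˡ (route i) ≡ lastEdgeˡ (k j)
    route-last j with C j
    ... | i , X∈κ = i , last-agrees (continuation i)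
      where
      last-agrees : (c : Continuation i) → lastEdgeˡ (before (st i) ++ X st i ∷ rest c) ≡ lastEdgeˡ (k j)
      last-agrees (at-v x≡v) = ⊥-elim (v∉κ j (subst (_∈ κ j) x≡v X∈κ))
      last-agrees (along j' p q (X∈κ' , _) e) with κ-owner j' j X∈κ' X∈κ
      ... | refl = trans (lastEdge-++-last (before (st i)) q)
                     (trans (sym (lastEdge-++-last p q)) (cong lastEdgeˡ (sym (k-split j p e))))

  -- Kept abstract: the rerouted walks are used only through the listed properties,
  -- and unfolding them would run the pointer procedure during type checking.
  abstract
    rerouted : Rerouted
    rerouted with final
    ... | st , P , C , S = record
      { route = route ; route-chain = route-chain ; route-unique = route-unique
      ; route-meet = route-meet ; route-⊆ = route-⊆ ; route-last = route-last }
      where open Extract st P C S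

module PathSystems {n} {H : Digraph n} {r v : Fin n} where
  open Chains H

  shared-end : (Ps : PathSystem H r v) → ∀ i i' → i ≢ i' → ∀ {y} →
    y ∈ verts (walk (path Ps i)) → y ∈ verts (walk (path Ps i')) → y ≡ r ⊎ y ≡ v
  shared-end Ps i i' i≢i' {y} m m' with y ≟ r | y ≟ v
  ... | yes y≡r | _       = inj₁ y≡r
  ... | no  _   | yes y≡v = inj₂ y≡v
  ... | no  y≢r | no  y≢v = ⊥-elim (intDisjoint Ps i i' i≢i' y
    (∈-interior (walk (path Ps i)) m y≢r y≢v) (∈-interior (walk (path Ps i')) m' y≢r y≢v))

  final-segments : (Ps : PathSystem H r v) (pre post : Fin (size Ps) → List V) (x : Fin (size Ps) → V) →
    (∀ i → verts (walk (path Ps i)) ≡ pre i ++ x i ∷ post i) → (∀ i → x i ≢ r) → Fan v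
  final-segments Ps pre post x split x≢r = record
    { size   = size Ps
    ; start  = x
    ; seq    = λ i → x i ∷ post i
    ; chain  = λ i → proj₂ (chain-split (pre i) (subst (λ l → Chain r l v) (split i) (walk→chain (walk (path Ps i)))))
    ; unique = λ i → unique-++⁻ʳ (pre i) (path-unique i)
    ; meet   = λ i i' i≢i' m m' →
        [ (λ { refl → ⊥-elim (r∉segment i m) }) , id ]′ (shared-end Ps i i' i≢i' (segment⊆path i m) (segment⊆path i' m'))
    }
    where
    path-unique : ∀ i → Unique (pre i ++ x i ∷ post i)
    path-unique i = subst Unique (split i) (unique (path Ps i))

    segment⊆path : ∀ i {y} → y ∈ x i ∷ post i → y ∈ verts (walk (path Ps i))
    segment⊆path i {y} m = subst (y ∈_) (sym (split i)) (∈-++⁺ʳ (pre i) m)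

    r∉segment : ∀ i → r ∉ x i ∷ post i
    r∉segment i (here r≡x)  = x≢r i (sym r≡x)
    r∉segment i (there r∈) with chain-head (walk→chain (walk (path Ps i)))
    ... | _ , starts-at-r = head∉suffix (pre i) (path-unique i) (trans (sym starts-at-r) (split i)) r∈

  separated : ∀ {S : Subset n} {y xs ys} → IsSeparation H r v S → Chain r xs y → Chain y ys v →
    (∀ {z} → z ∈ xs → ¬ z Sub.∈ S) → (∀ {z} → z ∈ ys → ¬ z Sub.∈ S) → ⊥
  separated sep c₁ c₂ avoid₁ avoid₂ with chain-last c₁
  ... | p , refl with chain→path (chain-join p c₁ c₂)
  ... | r-v-path , ⊆joined with proj₂ (proj₂ sep) r-v-path
  ... | z , z∈path , z∈S with ∈-++⁻ p (⊆joined z∈path)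
  ...   | inj₁ z∈p  = avoid₁ (∈-++⁺ˡ z∈p) z∈S
  ...   | inj₂ z∈ys = avoid₂ z∈ys z∈S

-- Write Q i = A i · s i · B i with s i its vertex in S, and P j = X j · t j · C j
-- with t j its last vertex in S.  R i follows A i to s i and continues along the
-- i-th walk of the fan obtained by rerouting the segments s i · B i along the
-- segments t j · C j.  The segments A i never meet the C j because S separates.
module Augment {n} {H : Digraph n} {r v : Fin n} {S : Subset n}
  (sep : IsSeparation H r v S) (Q : PathSystem H r v) (Q⊥S : Orthogonal Q S) (P : PathSystem H r v) where
  open Chains H
  open Crossings S
  open PathSystems

  ∈S⇒≢r : ∀ {x} → x Sub.∈ S → x ≢ r
  ∈S⇒≢r x∈S refl = proj₁ sep x∈S

  ∈S⇒≢v : ∀ {x} → x Sub.∈ S → x ≢ v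
  ∈S⇒≢v x∈S refl = proj₁ (proj₂ sep) x∈S

  Q-crossing : ∀ i → CrossesOnce (verts (walk (path Q i)))
  Q-crossing i = crosses-once (verts (walk (path Q i))) (proj₁ Q⊥S i)

  open module Qᶜ i = CrossesOnce (Q-crossing i) using ()
    renaming (pre to A; mid to s; post to B; split to Q-split; pre-avoids to A-avoids; mid∈S to s∈S; post-avoids to B-avoids)

  P-crossing : ∀ j → LastCrossing (verts (walk (path P j)))
  P-crossing j with proj₂ (proj₂ sep) (path P j)
  ... | x , x∈P , x∈S = last-crossing (verts (walk (path P j))) x∈P x∈S

  open module Pᶜ j = LastCrossing (P-crossing j) using ()
    renaming (pre to X; mid to t; post to C; split to P-split; mid∈S to t∈S; post-avoids to C-avoids)

  L : Fan v
  L = final-segments Q A B s Q-split (λ i → ∈S⇒≢r (s∈S i))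

  K : Fan v
  K = final-segments P X C t P-split (λ j → ∈S⇒≢r (t∈S j))

  -- Each t j is in S, hence on some path of Q, where s i is the only vertex of S.
  t-is-some-s : ∀ j → ∃ λ i → t j ≡ s i
  t-is-some-s j with proj₂ Q⊥S (t j) (t∈S j)
  ... | i , t∈Q = i , only-crossing (A i) (A-avoids i) (B-avoids i) (subst (t j ∈_) (Q-split i) t∈Q) (t∈S j)

  open Rerouting.Rerouted (Rerouting.rerouted L K (λ j → ∈S⇒≢v (t∈S j)) t-is-some-s)

  Q-chain : ∀ i → Chain r (A i ++ s i ∷ B i) v
  Q-chain i = subst (λ l → Chain r l v) (Q-split i) (walk→chain (walk (path Q i)))

  Q-unique : ∀ i → Unique (A i ++ s i ∷ B i)
  Q-unique i = subst Unique (Q-split i) (unique (path Q i))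

  A⊆Q : ∀ i {y} → y ∈ A i → y ∈ verts (walk (path Q i))
  A⊆Q i {y} m = subst (y ∈_) (sym (Q-split i)) (∈-++⁺ˡ m)

  segment⊆Q : ∀ i {y} → y ∈ s i ∷ B i → y ∈ verts (walk (path Q i))
  segment⊆Q i {y} m = subst (y ∈_) (sym (Q-split i)) (∈-++⁺ʳ (A i) m)

  A-chain : ∀ i → Chain r (A i ++ [ s i ]) (s i)
  A-chain i = proj₁ (chain-split (A i) (Q-chain i))

  A-C-disjoint : ∀ i j {y} → y ∈ A i → y ∈ C j → ⊥
  A-C-disjoint i j {y} y∈A y∈C with ∈-∃++ y∈A | ∈-∃++ y∈C
  ... | A₁ , A₂ , A≡ | C₁ , C₂ , C≡ = separated sep to-y from-y avoid₁ avoid₂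
    where
    to-y : Chain r (A₁ ++ [ y ]) y
    to-y = proj₁ (chain-split A₁ (subst (λ l → Chain r l (s i))
      (trans (cong (_++ [ s i ]) A≡) (++-assoc A₁ (y ∷ A₂) [ s i ])) (A-chain i)))
    from-y : Chain y (y ∷ C₂) v
    from-y = proj₂ (chain-split (t j ∷ C₁) (subst (λ l → Chain (t j) (t j ∷ l) v) C≡ (Fan.chain K j)))
    avoid₁ : ∀ {z} → z ∈ A₁ ++ [ y ] → ¬ z Sub.∈ S
    avoid₁ m with ∈-++⁻ A₁ m
    ... | inj₁ z∈A₁        = All.lookup (A-avoids i) (subst (_ ∈_) (sym A≡) (∈-++⁺ˡ z∈A₁))
    ... | inj₂ (here refl) = All.lookup (A-avoids i) y∈A
    avoid₂ : ∀ {z} → z ∈ y ∷ C₂ → ¬ z Sub.∈ S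
    avoid₂ (here refl) = All.lookup (C-avoids j) y∈C
    avoid₂ (there m)   = All.lookup (C-avoids j) (subst (_ ∈_) (sym C≡) (∈-++⁺ʳ C₁ (there m)))

  route-origin : ∀ i {y} → y ∈ route i → y ∈ s i ∷ B i ⊎ ∃ λ j → y ∈ C j
  route-origin i m with route-⊆ i m
  ... | inj₁ y∈segment             = inj₁ y∈segment
  ... | inj₂ (j , here y≡t , y≢t)  = ⊥-elim (y≢t y≡t)
  ... | inj₂ (j , there y∈C , _)   = inj₂ (j , y∈C)

  R-seq : Fin (size Q) → List V
  R-seq i = A i ++ route i

  R-chain : ∀ i → Chain r (R-seq i) v
  R-chain i = chain-join (A i) (A-chain i) (route-chain i)

  R-unique : ∀ i → Unique (R-seq i)
  R-unique i = Unique.++⁺ (unique-++⁻ˡ (A i) (Q-unique i)) (route-unique i) disjoint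
    where
    disjoint : ∀ {y} → y ∈ A i × y ∈ route i → ⊥
    disjoint (y∈A , y∈route) with route-origin i y∈route
    ... | inj₁ y∈segment = unique-++⁻-disjoint (A i) (Q-unique i) y∈A y∈segment
    ... | inj₂ (j , y∈C) = A-C-disjoint i j y∈A y∈C

  R-meet : ∀ i i' → i ≢ i' → ∀ {y} → y ∈ R-seq i → y ∈ R-seq i' → y ≡ r ⊎ y ≡ v
  R-meet i i' i≢i' m m' with ∈-++⁻ (A i) m | ∈-++⁻ (A i') m'
  ... | inj₁ y∈A | inj₁ y∈A' = shared-end Q i i' i≢i' (A⊆Q i y∈A) (A⊆Q i' y∈A')
  ... | inj₁ y∈A | inj₂ y∈route' with route-origin i' y∈route'
  ...   | inj₁ y∈segment = shared-end Q i i' i≢i' (A⊆Q i y∈A) (segment⊆Q i' y∈segment)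
  ...   | inj₂ (j , y∈C) = ⊥-elim (A-C-disjoint i j y∈A y∈C)
  R-meet i i' i≢i' m m' | inj₂ y∈route | inj₁ y∈A' with route-origin i y∈route
  ...   | inj₁ y∈segment = shared-end Q i i' i≢i' (segment⊆Q i y∈segment) (A⊆Q i' y∈A')
  ...   | inj₂ (j , y∈C) = ⊥-elim (A-C-disjoint i' j y∈A' y∈C)
  R-meet i i' i≢i' m m' | inj₂ y∈route | inj₂ y∈route' = inj₂ (route-meet i i' i≢i' y∈route y∈route')

  R-walk : ∀ i → Σ (Walk H r v) λ w → verts w ≡ R-seq i
  R-walk i = chain→walk (R-chain i)

  R-path : Fin (size Q) → Path H r v
  R-path i = mkPath (proj₁ (R-walk i)) (subst Unique (sym (proj₂ (R-walk i))) (R-unique i))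

  R-verts : ∀ i → verts (walk (R-path i)) ≡ R-seq i
  R-verts i = proj₂ (R-walk i)

  s∈R : ∀ i → s i ∈ verts (walk (R-path i))
  s∈R i with chain-head (route-chain i)
  ... | _ , route≡ = subst (s i ∈_) (sym (trans (R-verts i) (cong (A i ++_) route≡))) (∈-++⁺ʳ (A i) (here refl))

  R : PathSystem H r v
  R = record
    { size        = size Q
    ; path        = R-path
    ; distinct    = λ i i' i≢i' same → s-not-end i (R-meet i i' i≢i' (on-R i (s∈R i)) (on-R i' (subst (s i ∈_) same (s∈R i))))
    ; intDisjoint = λ i i' i≢i' x m m' →
        let (x∈R , x≢r , x≢v) = interior⁻ (walk (R-path i)) (unique (R-path i)) m
            (x∈R' , _ , _)     = interior⁻ (walk (R-path i')) (unique (R-path i')) m'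
        in [ x≢r , x≢v ]′ (R-meet i i' i≢i' (on-R i x∈R) (on-R i' x∈R'))
    }
    where
    on-R : ∀ i {y} → y ∈ verts (walk (R-path i)) → y ∈ R-seq i
    on-R i {y} = subst (y ∈_) (R-verts i)
    s-not-end : ∀ i → s i ≡ r ⊎ s i ≡ v → ⊥
    s-not-end i = [ ∈S⇒≢r (s∈S i) , ∈S⇒≢v (s∈S i) ]′

  R⊥S : Orthogonal R S
  R⊥S = crosses-once-R , covers
    where
    crosses-once-R : ∀ i → count (verts (walk (R-path i))) ≡ 1
    crosses-once-R i with chain-head (route-chain i)
    ... | tl , route≡ = trans (cong count (trans (R-verts i) (cong (A i ++_) route≡)))
                              (count-one (A i) (A-avoids i) (s∈S i) (All.tabulate tl-avoids))
      where
      tl-avoids : ∀ {y} → y ∈ tl → ¬ y Sub.∈ S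
      tl-avoids {y} y∈tl with route-origin i (subst (y ∈_) (sym route≡) (there y∈tl))
      ... | inj₁ (here refl)  = ⊥-elim (Unique[x∷xs]⇒x∉xs (subst Unique route≡ (route-unique i)) y∈tl)
      ... | inj₁ (there y∈B)  = All.lookup (B-avoids i) y∈B
      ... | inj₂ (j , y∈C)    = All.lookup (C-avoids j) y∈C
    covers : ∀ x → x Sub.∈ S → ∃ λ i → x ∈ verts (walk (R-path i))
    covers x x∈S with proj₂ Q⊥S x x∈S
    ... | i , x∈Q = i , subst (_∈ verts (walk (R-path i)))
      (sym (only-crossing (A i) (A-avoids i) (B-avoids i) (subst (x ∈_) (Q-split i) x∈Q) x∈S)) (s∈R i)

  E⁺P⊆E⁺R : lastEdges P ⊆ᴱ lastEdges R
  E⁺P⊆E⁺R e (j , last-P) with route-last j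
  ... | i , same-last = i , (begin
    lastEdge (walk (R-path i))                   ≡⟨ lastEdge-verts (walk (R-path i)) ⟩
    lastEdgeˡ (verts (walk (R-path i)))          ≡⟨ cong lastEdgeˡ (R-verts i) ⟩
    lastEdgeˡ (A i ++ route i)                   ≡⟨ lastEdge-++-chain (A i) (route-chain i) (∈S⇒≢v (s∈S i)) ⟩
    lastEdgeˡ (route i)                          ≡⟨ same-last ⟩
    lastEdgeˡ (t j ∷ C j)                        ≡⟨ lastEdge-++-chain (X j) (Fan.chain K j) (∈S⇒≢v (t∈S j)) ⟨
    lastEdgeˡ (X j ++ t j ∷ C j)                 ≡⟨ cong lastEdgeˡ (P-split j) ⟨
    lastEdgeˡ (verts (walk (path P j)))          ≡⟨ lastEdge-verts (walk (path P j)) ⟨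
    lastEdge (walk (path P j))                   ≡⟨ last-P ⟩
    just e                                       ∎)
    where open ≡-Reasoning

-- The augmented system R lies in 𝔓_D(v), witnessed by S itself.
lemma2p4 : ∀ {n} (D : Digraph n) (r v : Fin n) → v ≢ r →
    ∀ (I : EdgeSet n) → 𝒢 (delEdge D r v) r v I →
    ∀ (S : Subset n) → IsIn𝔖 D r v S →
    Σ (PathSystem (delEdge D r v) r v) (λ R →
    IsIn𝔓 D r v R × Orthogonal R S × (I ⊆ᴱ lastEdges R))
lemma2p4 D r v _ I (_ , P , I⊆E⁺P , _) S (sep , Q , Q⊥S) =
  R , (S , sep , R⊥S) , R⊥S , λ e e∈I → E⁺P⊆E⁺R e (I⊆E⁺P e e∈I)
  where open Augment sep Q Q⊥S P
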